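{- Let $f:2^E\to\mathbb{R}_{\ge0}$ be monotone submodular with $f(\varnothing)=0$ and let $x\in\mathbb{R}^E_{\ge0}$. Then $w^{(x)}_e\le 1$ for all $e\in E$ if and only if $x(S)\le f(S)$ for all $S\subseteq E$.
   Context: For $x\in\mathbb{R}^E_{\ge0}$ and $e\in E$, the water level is $w^{(x)}_e:=\max_{S\ni e}\min_{T\subseteq E,\ f_T(\{e\})\neq0}\frac{x(S\setminus T)}{f_T(S)}$, where $x(S):=\sum_{e'\in S}x_{e'}$ and $f_T(S):=f(S\cup T)-f(T)$. -}

module Defs where

open import Level using (0ℓ)
open import Data.Nat using (ℕ; zero; suc)
open import Data.Fin using (Fin)
open import Data.Fin.Subset using (Subset; inside; outside; _∈_; _⊆_; _∪_; _∩_; _─_; ⁅_⁆; ⊥)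
open import Data.Fin.Subset.Properties using (_∈?_)
open import Data.Vec using (Vec; []; _∷_)
open import Data.List using (List; []; _∷_; map; filter; foldr; _++_)
open import Data.Maybe using (Maybe; just; nothing)
open import Data.Unit using (⊤)
open import Data.Empty using () renaming (⊥ to Empty)
open import Relation.Nullary using (¬_; yes; no)
open import Relation.Nullary.Decidable using (¬?)
open import Relation.Binary.PropositionalEquality using (_≡_)
open import Algebra.Structures using (IsCommutativeRing)
open import Relation.Binary.Structures using (IsDecTotalOrder)

-- Ordered fields (the paper works over ℝ; we work over an arbitrary
-- discrete linearly ordered field, of which ℝ is an instance).
-- Inverse is total; only its value on nonzero elements is constrained.

record OrderedField : Set₁ where
  infixl 6 _+_ _-_
  infixl 7 _*_
  infix 4 _≤_ _<_
  field
    Carrier : Set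
    _+_ _*_ : Carrier → Carrier → Carrier
    -_      : Carrier → Carrier
    0# 1#   : Carrier
    _⁻¹     : Carrier → Carrier
    _≤_     : Carrier → Carrier → Set
    isCommutativeRing : IsCommutativeRing _≡_ _+_ _*_ -_ 0# 1#
    isDecTotalOrder   : IsDecTotalOrder _≡_ _≤_
    0≢1     : ¬ (0# ≡ 1#)
    ⁻¹-inverse : ∀ x → ¬ (x ≡ 0#) → x * (x ⁻¹) ≡ 1#
    +-mono-≤   : ∀ {x y} z → x ≤ y → x + z ≤ y + z
    *-nonneg   : ∀ {x y} → 0# ≤ x → 0# ≤ y → 0# ≤ x * y

  _-_ : Carrier → Carrier → Carrier
  x - y = x + (- y)

  _<_ : Carrier → Carrier → Set
  x < y = x ≤ y × ¬ (x ≡ y)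
    where open import Data.Product using (_×_)

  _/_ : Carrier → Carrier → Carrier
  x / y = x * (y ⁻¹)

  open IsDecTotalOrder isDecTotalOrder public using (_≟_; _≤?_)

  min max : Carrier → Carrier → Carrier
  min x y with x ≤? y
  ... | yes _ = x
  ... | no  _ = y
  max x y with x ≤? y
  ... | yes _ = y
  ... | no  _ = x

  -- extended values: nothing = +∞ (the minimum of the empty family)
  Ext : Set
  Ext = Maybe Carrier

  minE : Ext → Ext → Ext
  minE nothing  b        = b
  minE (just a) nothing  = just a
  minE (just a) (just b) = just (min a b)

  maxE : Ext → Ext → Ext
  maxE nothing  _        = nothing
  maxE (just a) nothing  = nothing
  maxE (just a) (just b) = just (max a b)

  _≤E_ : Ext → Carrier → Set
  nothing ≤E c = Empty
  just a  ≤E c = a ≤ c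

allSubsets : ∀ n → List (Subset n)
allSubsets zero    = [] ∷ []
allSubsets (suc n) = map (inside ∷_) (allSubsets n) ++ map (outside ∷_) (allSubsets n)

module _ (F : OrderedField) where
  open OrderedField F

  sumOver : ∀ {n} → (Fin n → Carrier) → Subset n → Carrier
  sumOver {zero}  x []            = 0#
  sumOver {suc n} x (inside  ∷ S) = x Fin.zero + sumOver (λ i → x (Fin.suc i)) S
    where import Data.Fin as Fin
  sumOver {suc n} x (outside ∷ S) = sumOver (λ i → x (Fin.suc i)) S
    where import Data.Fin as Fin

  contract : ∀ {n} → (Subset n → Carrier) → Subset n → Subset n → Carrier
  contract f T S = f (S ∪ T) - f T

  Monotone : ∀ {n} → (Subset n → Carrier) → Set
  Monotone f = ∀ S T → S ⊆ T → f S ≤ f T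

  Submodular : ∀ {n} → (Subset n → Carrier) → Set
  Submodular f = ∀ S T → f (S ∪ T) + f (S ∩ T) ≤ f S + f T

  innerMin : ∀ {n} → (Subset n → Carrier) → (Fin n → Carrier) → Fin n → Subset n → Ext
  innerMin {n} f x e S =
    foldr (λ T acc → minE (just (sumOver x (S ─ T) / contract f T S)) acc) nothing
      (filter (λ T → ¬? (contract f T ⁅ e ⁆ ≟ 0#)) (allSubsets n))

  -- water level w^{(x)}_e = max over S ∋ e of innerMin (S = {e} is used as seed)
  waterLevel : ∀ {n} → (Subset n → Carrier) → (Fin n → Carrier) → Fin n → Ext
  waterLevel {n} f x e =
    foldr (λ S acc → maxE (innerMin f x e S) acc) (innerMin f x e ⁅ e ⁆)
      (filter (e ∈?_) (allSubsets n))

{-# OPTIONS --safe #-}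

-- Choosing T = ∅ in the inner minimum bounds w_e by max_{S ∋ e} x(S)/f(S), which is at most 1
-- when x ≤ f on all sets. Conversely, by well-founded induction on S under ⊂: for e ∈ S, w_e ≤ 1
-- provides T with f_T({e}) ≠ 0, hence e ∉ T and f_T(S) ≥ f_T({e}) > 0, and x(S ∖ T) ≤ f_T(S).
-- Then S ∩ T ⊊ S, and submodularity gives x(S) = x(S ∖ T) + x(S ∩ T) ≤ f_T(S) + f(S ∩ T) ≤ f(S).

module Submission where

open import Defs
open import Data.Nat using (ℕ)
open import Data.Fin using (Fin)
open import Data.Fin.Subset using (Subset; ⁅_⁆; ⊥)
open import Data.Product using (_×_)
open import Function.Bundles using (_⇔_)
open import Relation.Binary.PropositionalEquality using (_≡_)

open import Level using (0ℓ)
open import Algebra.Bundles using (CommutativeRing)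
import Algebra.Properties.CommutativeSemigroup as CommutativeSemigroupProperties
import Algebra.Properties.Ring as RingProperties
open import Data.Empty using (⊥-elim)
open import Data.Fin using (zero; suc)
open import Data.Fin.Subset using (inside; outside; _∈_; _∉_; _⊆_; _⊂_; _∪_; _∩_; _─_)
open import Data.Fin.Subset.Induction using (⊂-wellFounded)
open import Data.Fin.Subset.Properties
  using ( _∈?_; nonempty?; Empty-unique; p─⊥≡p; p∩q⊆p; x∈p∩q⁻; ∪-identityʳ; p⊆p∪q; q⊆p∪q; x∈p∪q⁻
        ; x∈⁅x⁆; x∈⁅y⁆⇒x≡y; ⊆-antisym)
open import Data.List using (List; []; _∷_; map; filter; foldr; _++_)
open import Data.List.Membership.Propositional using (find; lose) renaming (_∈_ to _∈ˡ_)
open import Data.List.Membership.Propositional.Properties using (∈-map⁺; ∈-++⁺ˡ; ∈-++⁺ʳ; ∈-filter⁺; ∈-filter⁻)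
open import Data.List.Relation.Unary.All as All using (All; []; _∷_)
open import Data.List.Relation.Unary.Any using (Any; here; there)
open import Data.Vec using ([]; _∷_)
open import Data.Maybe using (just; nothing)
open import Data.Product using (_,_; proj₁; proj₂; ∃-syntax)
open import Data.Sum using (_⊎_; inj₁; inj₂; [_,_]′)
open import Function.Base using (_∘_; id)
open import Function.Bundles using (mk⇔; Equivalence)
open import Induction.WellFounded using (module All)
open import Relation.Binary.Bundles using (Poset)
open import Relation.Binary.Structures using (IsDecTotalOrder)
import Relation.Binary.Construct.NonStrictToStrict as ToStrict
open import Relation.Binary.PropositionalEquality using (_≢_; refl; sym; trans; cong; cong₂; subst; ≢-sym)
import Relation.Binary.Reasoning.PartialOrder as ≤-Reasoning
open import Relation.Nullary using (¬_; yes; no)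
open import Relation.Nullary.Decidable using (¬?)
open import Relation.Unary using (Decidable)

open Equivalence

module OrderedFieldProperties (F : OrderedField) where
  open OrderedField F

  commutativeRing : CommutativeRing 0ℓ 0ℓ
  commutativeRing = record { isCommutativeRing = isCommutativeRing }

  open CommutativeRing commutativeRing public
    using ( +-assoc; +-comm; +-identityˡ; +-identityʳ; *-assoc; *-comm; *-identityˡ; *-identityʳ
          ; -‿inverseʳ; ring; +-commutativeSemigroup)
  open RingProperties ring public
    using (-‿involutive; -‿distribˡ-*; -‿distribʳ-*; [y-z]x≈yx-zx; //-rightDividesˡ; //-rightDividesʳ; -0#≈0#)
  open CommutativeSemigroupProperties +-commutativeSemigroup public
    using (x∙yz≈y∙xz; xy∙z≈xz∙y)

  poset : Poset 0ℓ 0ℓ 0ℓ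
  poset = record { isPartialOrder = IsDecTotalOrder.isPartialOrder isDecTotalOrder }

  open Poset poset public
    using () renaming (refl to ≤-refl; reflexive to ≤-reflexive; trans to ≤-trans; antisym to ≤-antisym)
  open IsDecTotalOrder isDecTotalOrder public using () renaming (total to ≤-total)
  open ≤-Reasoning poset

  <-≤-trans : ∀ {a b c} → a < b → b ≤ c → a < c
  <-≤-trans = ToStrict.<-≤-trans _≡_ _≤_ sym ≤-trans ≤-antisym (λ { refl a≤b → a≤b })

  ≰⇒≥ : ∀ {a b} → ¬ a ≤ b → b ≤ a
  ≰⇒≥ {a} {b} a≰b = [ (λ a≤b → ⊥-elim (a≰b a≤b)) , id ]′ (≤-total a b)

  +-mono-≤₂ : ∀ {a b c d} → a ≤ b → c ≤ d → a + c ≤ b + d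
  +-mono-≤₂ {a} {b} {c} {d} a≤b c≤d = begin
    a + c ≤⟨ +-mono-≤ c a≤b ⟩
    b + c ≡⟨ +-comm b c ⟩
    c + b ≤⟨ +-mono-≤ b c≤d ⟩
    d + b ≡⟨ +-comm d b ⟩
    b + d ∎

  x≤y⇒0≤y-x : ∀ {a b} → a ≤ b → 0# ≤ b - a
  x≤y⇒0≤y-x {a} {b} a≤b = begin
    0#    ≡⟨ sym (-‿inverseʳ a) ⟩
    a - a ≤⟨ +-mono-≤ (- a) a≤b ⟩
    b - a ∎

  0≤y-x⇒x≤y : ∀ {a b} → 0# ≤ b - a → a ≤ b
  0≤y-x⇒x≤y {a} {b} 0≤b-a = begin
    a           ≡⟨ sym (+-identityˡ a) ⟩
    0# + a      ≤⟨ +-mono-≤ a 0≤b-a ⟩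
    b - a + a   ≡⟨ //-rightDividesˡ a b ⟩
    b           ∎

  *-monoˡ-≤-nonneg : ∀ {a b c} → 0# ≤ c → a ≤ b → a * c ≤ b * c
  *-monoˡ-≤-nonneg {a} {b} {c} 0≤c a≤b = 0≤y-x⇒x≤y (begin
    0#              ≤⟨ *-nonneg (x≤y⇒0≤y-x a≤b) 0≤c ⟩
    (b - a) * c     ≡⟨ [y-z]x≈yx-zx c b a ⟩
    b * c - a * c   ∎)

  square-nonneg : ∀ a → 0# ≤ a * a
  square-nonneg a with ≤-total 0# a
  ... | inj₁ 0≤a = *-nonneg 0≤a 0≤a
  ... | inj₂ a≤0 = begin
    0#          ≤⟨ *-nonneg 0≤-a 0≤-a ⟩
    - a * - a   ≡⟨ sym (-‿distribˡ-* a (- a)) ⟩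
    - (a * - a) ≡⟨ cong -_ (sym (-‿distribʳ-* a a)) ⟩
    - - (a * a) ≡⟨ -‿involutive (a * a) ⟩
    a * a       ∎
    where
    0≤-a : 0# ≤ - a
    0≤-a = subst (0# ≤_) (+-identityˡ (- a)) (x≤y⇒0≤y-x a≤0)

  pos⇒⁻¹-nonneg : ∀ {b} → 0# < b → 0# ≤ b ⁻¹
  pos⇒⁻¹-nonneg {b} (0≤b , 0≢b) = begin
    0#                  ≤⟨ *-nonneg 0≤b (square-nonneg (b ⁻¹)) ⟩
    b * (b ⁻¹ * b ⁻¹)   ≡⟨ sym (*-assoc b (b ⁻¹) (b ⁻¹)) ⟩
    b * b ⁻¹ * b ⁻¹     ≡⟨ cong (_* b ⁻¹) (⁻¹-inverse b (≢-sym 0≢b)) ⟩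
    1# * b ⁻¹           ≡⟨ *-identityˡ (b ⁻¹) ⟩
    b ⁻¹                ∎

  /≤1⇔≤ : ∀ {a b} → 0# < b → (a / b ≤ 1# ⇔ a ≤ b)
  /≤1⇔≤ {a} {b} 0<b@(0≤b , 0≢b) = mk⇔ to′ from′
    where
    b*b⁻¹≡1 : b * b ⁻¹ ≡ 1#
    b*b⁻¹≡1 = ⁻¹-inverse b (≢-sym 0≢b)

    to′ : a / b ≤ 1# → a ≤ b
    to′ a/b≤1 = begin
      a               ≡⟨ sym (*-identityʳ a) ⟩
      a * 1#          ≡⟨ cong (a *_) (sym (trans (*-comm (b ⁻¹) b) b*b⁻¹≡1)) ⟩
      a * (b ⁻¹ * b)  ≡⟨ sym (*-assoc a (b ⁻¹) b) ⟩
      a / b * b       ≤⟨ *-monoˡ-≤-nonneg 0≤b a/b≤1 ⟩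
      1# * b          ≡⟨ *-identityˡ b ⟩
      b               ∎

    from′ : a ≤ b → a / b ≤ 1#
    from′ a≤b = begin
      a * b ⁻¹  ≤⟨ *-monoˡ-≤-nonneg (pos⇒⁻¹-nonneg 0<b) a≤b ⟩
      b * b ⁻¹  ≡⟨ b*b⁻¹≡1 ⟩
      1#        ∎

x∈p⇒⁅x⁆⊆p : ∀ {n} {x : Fin n} {p} → x ∈ p → ⁅ x ⁆ ⊆ p
x∈p⇒⁅x⁆⊆p {x = x} {p} x∈p y∈⁅x⁆ = subst (_∈ p) (sym (x∈⁅y⁆⇒x≡y x y∈⁅x⁆)) x∈p

∪-monoˡ-⊆ : ∀ {n} {p q : Subset n} r → p ⊆ q → p ∪ r ⊆ q ∪ r
∪-monoˡ-⊆ {p = p} {q} r p⊆q y∈p∪r = [ p⊆p∪q r ∘ p⊆q , q⊆p∪q q r ]′ (x∈p∪q⁻ p r y∈p∪r)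

p⊆q⇒p∪q≡q : ∀ {n} {p q : Subset n} → p ⊆ q → p ∪ q ≡ q
p⊆q⇒p∪q≡q {p = p} {q} p⊆q = ⊆-antisym (λ y∈p∪q → [ p⊆q , id ]′ (x∈p∪q⁻ p q y∈p∪q)) (q⊆p∪q p q)

∈-allSubsets : ∀ {n} (S : Subset n) → S ∈ˡ allSubsets n
∈-allSubsets []                      = here refl
∈-allSubsets {ℕ.suc n} (inside ∷ S)  = ∈-++⁺ˡ (∈-map⁺ (inside ∷_) (∈-allSubsets S))
∈-allSubsets {ℕ.suc n} (outside ∷ S) =
  ∈-++⁺ʳ (map (inside ∷_) (allSubsets n)) (∈-map⁺ (outside ∷_) (∈-allSubsets S))

module _ (F : OrderedField) where
  open OrderedField F
  open OrderedFieldProperties F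
  open ≤-Reasoning poset

  sumOver-⊥ : ∀ {n} (x : Fin n → Carrier) → sumOver F x ⊥ ≡ 0#
  sumOver-⊥ {ℕ.zero}  x = refl
  sumOver-⊥ {ℕ.suc n} x = sumOver-⊥ (x ∘ suc)

  sumOver-split : ∀ {n} (x : Fin n → Carrier) S T →
                  sumOver F x S ≡ sumOver F x (S ─ T) + sumOver F x (S ∩ T)
  sumOver-split x []            []            = sym (+-identityʳ 0#)
  sumOver-split x (inside ∷ S)  (inside ∷ T)  =
    trans (cong (x zero +_) (sumOver-split (x ∘ suc) S T)) (x∙yz≈y∙xz _ _ _)
  sumOver-split x (inside ∷ S)  (outside ∷ T) =
    trans (cong (x zero +_) (sumOver-split (x ∘ suc) S T)) (sym (+-assoc _ _ _))
  sumOver-split x (outside ∷ S) (inside ∷ T)  = sumOver-split (x ∘ suc) S T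
  sumOver-split x (outside ∷ S) (outside ∷ T) = sumOver-split (x ∘ suc) S T

  min≤ˡ : ∀ a b → min a b ≤ a
  min≤ˡ a b with a ≤? b
  ... | yes _   = ≤-refl
  ... | no  a≰b = ≰⇒≥ a≰b

  min≤ʳ : ∀ a b → min a b ≤ b
  min≤ʳ a b with a ≤? b
  ... | yes a≤b = a≤b
  ... | no  _   = ≤-refl

  min-≤⇒⊎ : ∀ {a b c} → min a b ≤ c → a ≤ c ⊎ b ≤ c
  min-≤⇒⊎ {a} {b} with a ≤? b
  ... | yes _ = inj₁
  ... | no  _ = inj₂

  max-≤⇔ : ∀ {a b c} → max a b ≤ c ⇔ (a ≤ c × b ≤ c)
  max-≤⇔ {a} {b} {c} with a ≤? b
  ... | yes a≤b = mk⇔ (λ b≤c → ≤-trans a≤b b≤c , b≤c) proj₂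
  ... | no  a≰b = mk⇔ (λ a≤c → a≤c , ≤-trans (≰⇒≥ a≰b) a≤c) proj₁

  minE-≤E⇔ : ∀ {a} m {c} → minE (just a) m ≤E c ⇔ (a ≤ c ⊎ m ≤E c)
  minE-≤E⇔ nothing  = mk⇔ inj₁ [ id , (λ ()) ]′
  minE-≤E⇔ {a} (just b) = mk⇔ min-≤⇒⊎ [ ≤-trans (min≤ˡ a b) , ≤-trans (min≤ʳ a b) ]′

  maxE-≤E⇔ : ∀ a b {c} → maxE a b ≤E c ⇔ (a ≤E c × b ≤E c)
  maxE-≤E⇔ nothing  _        = mk⇔ (λ ()) (λ ())
  maxE-≤E⇔ (just a) nothing  = mk⇔ (λ ()) (λ ())
  maxE-≤E⇔ (just a) (just b) = max-≤⇔

  -- innerMin and waterLevel unfold definitionally to instances of these two folds.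
  minOver : {A : Set} → (A → Carrier) → List A → Ext
  minOver g = foldr (λ a m → minE (just (g a)) m) nothing

  maxOver : {A : Set} → (A → Ext) → Ext → List A → Ext
  maxOver h = foldr (λ a m → maxE (h a) m)

  minOver-≤E⇔ : ∀ {A : Set} (g : A → Carrier) as {c} → minOver g as ≤E c ⇔ Any (λ a → g a ≤ c) as
  minOver-≤E⇔ g []       = mk⇔ (λ ()) (λ ())
  minOver-≤E⇔ g (a ∷ as) = mk⇔
    ([ here , there ∘ to (minOver-≤E⇔ g as) ]′ ∘ to (minE-≤E⇔ (minOver g as)))
    (from (minE-≤E⇔ (minOver g as)) ∘
       λ { (here ga≤c) → inj₁ ga≤c ; (there any) → inj₂ (from (minOver-≤E⇔ g as) any) })

  maxOver-≤E⇔ : ∀ {A : Set} (h : A → Ext) s as {c} →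
                maxOver h s as ≤E c ⇔ (s ≤E c × All (λ a → h a ≤E c) as)
  maxOver-≤E⇔ h s []       = mk⇔ (_, []) proj₁
  maxOver-≤E⇔ h s (a ∷ as) {c} = mk⇔ to′ from′
    where
    to′ : maxOver h s (a ∷ as) ≤E c → s ≤E c × All (λ a → h a ≤E c) (a ∷ as)
    to′ ≤c = let ha≤c , rest≤c = to (maxE-≤E⇔ (h a) (maxOver h s as)) ≤c
                 s≤c , all≤c   = to (maxOver-≤E⇔ h s as) rest≤c
             in s≤c , ha≤c ∷ all≤c

    from′ : s ≤E c × All (λ a → h a ≤E c) (a ∷ as) → maxOver h s (a ∷ as) ≤E c
    from′ (s≤c , ha≤c ∷ all≤c) =
      from (maxE-≤E⇔ (h a) (maxOver h s as)) (ha≤c , from (maxOver-≤E⇔ h s as) (s≤c , all≤c))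

  module _ {n} (f : Subset n → Carrier) where

    contract-⊥ : f ⊥ ≡ 0# → ∀ S → contract F f ⊥ S ≡ f S
    contract-⊥ f⊥≡0 S = begin-equality
      f (S ∪ ⊥) - f ⊥ ≡⟨ cong₂ _-_ (cong f (∪-identityʳ S)) f⊥≡0 ⟩
      f S - 0#        ≡⟨ cong (f S +_) -0#≈0# ⟩
      f S + 0#        ≡⟨ +-identityʳ (f S) ⟩
      f S             ∎

    contract-⊆ : ∀ {S T} → S ⊆ T → contract F f T S ≡ 0#
    contract-⊆ {S} {T} S⊆T = trans (cong (λ U → f U - f T) (p⊆q⇒p∪q≡q S⊆T)) (-‿inverseʳ (f T))

    contract-nonneg : Monotone F f → ∀ T S → 0# ≤ contract F f T S
    contract-nonneg mono T S = x≤y⇒0≤y-x (mono T (S ∪ T) (q⊆p∪q S T))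

    contract-monoʳ : Monotone F f → ∀ T {S S′} → S ⊆ S′ → contract F f T S ≤ contract F f T S′
    contract-monoʳ mono T S⊆S′ = +-mono-≤ (- f T) (mono _ _ (∪-monoˡ-⊆ T S⊆S′))

    contract+∩≤ : Submodular F f → ∀ T S → contract F f T S + f (S ∩ T) ≤ f S
    contract+∩≤ sub T S = begin
      f (S ∪ T) - f T + f (S ∩ T)   ≡⟨ xy∙z≈xz∙y (f (S ∪ T)) (- f T) (f (S ∩ T)) ⟩
      f (S ∪ T) + f (S ∩ T) - f T   ≤⟨ +-mono-≤ (- f T) (sub S T) ⟩
      f S + f T - f T               ≡⟨ //-rightDividesʳ (f T) (f S) ⟩
      f S                           ∎

    module _ (x : Fin n → Carrier) (e : Fin n) where

      innerMin-≤E⇔ : ∀ S {c} → innerMin F f x e S ≤E c ⇔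
                     (∃[ T ] (contract F f T ⁅ e ⁆ ≢ 0# × sumOver F x (S ─ T) / contract F f T S ≤ c))
      innerMin-≤E⇔ S = mk⇔
        (λ ≤c → let T , T∈ , ratio≤c = find (to characterisation ≤c)
                in T , proj₂ (∈-filter⁻ admissible? {xs = allSubsets n} T∈) , ratio≤c)
        (λ { (T , T-admissible , ratio≤c) →
               from characterisation (lose (∈-filter⁺ admissible? (∈-allSubsets T) T-admissible) ratio≤c) })
        where
        admissible? : Decidable (λ T → contract F f T ⁅ e ⁆ ≢ 0#)
        admissible? T = ¬? (contract F f T ⁅ e ⁆ ≟ 0#)

        ratio : Subset n → Carrier
        ratio T = sumOver F x (S ─ T) / contract F f T S

        characterisation : ∀ {c} → innerMin F f x e S ≤E c ⇔
                           Any (λ T → ratio T ≤ c) (filter admissible? (allSubsets n))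
        characterisation = minOver-≤E⇔ ratio (filter admissible? (allSubsets n))

      waterLevel-≤E⇔ : ∀ {c} → waterLevel F f x e ≤E c ⇔ (∀ {S} → e ∈ S → innerMin F f x e S ≤E c)
      waterLevel-≤E⇔ {c} = mk⇔ to′ from′
        where
        characterisation : waterLevel F f x e ≤E c ⇔
                           (innerMin F f x e ⁅ e ⁆ ≤E c ×
                            All (λ S → innerMin F f x e S ≤E c) (filter (e ∈?_) (allSubsets n)))
        characterisation =
          maxOver-≤E⇔ (innerMin F f x e) (innerMin F f x e ⁅ e ⁆) (filter (e ∈?_) (allSubsets n))

        to′ : waterLevel F f x e ≤E c → ∀ {S} → e ∈ S → innerMin F f x e S ≤E c
        to′ ≤c e∈S =
          All.lookup (proj₂ (to characterisation ≤c)) (∈-filter⁺ (e ∈?_) (∈-allSubsets _) e∈S)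

        from′ : (∀ {S} → e ∈ S → innerMin F f x e S ≤E c) → waterLevel F f x e ≤E c
        from′ ≤c = from characterisation
          (≤c (x∈⁅x⁆ e) , All.tabulate (λ S∈ → ≤c (proj₂ (∈-filter⁻ (e ∈?_) {xs = allSubsets n} S∈))))

  module _ {n} {f : Subset n → Carrier} {x : Fin n → Carrier}
           (mono : Monotone F f) (f⊥≡0 : f ⊥ ≡ 0#) (f⁅⁆-pos : ∀ e → 0# < f ⁅ e ⁆) where

    f-pos : ∀ {e S} → e ∈ S → 0# < f S
    f-pos {e} e∈S = <-≤-trans (f⁅⁆-pos e) (mono _ _ (x∈p⇒⁅x⁆⊆p e∈S))

    sumOver≤f⇒waterLevel≤1 : (∀ S → sumOver F x S ≤ f S) → ∀ e → waterLevel F f x e ≤E 1#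
    sumOver≤f⇒waterLevel≤1 x≤f e = from (waterLevel-≤E⇔ f x e) innerMin≤1
      where
      ⊥-admissible : contract F f ⊥ ⁅ e ⁆ ≢ 0#
      ⊥-admissible = subst (_≢ 0#) (sym (contract-⊥ f f⊥≡0 ⁅ e ⁆)) (≢-sym (proj₂ (f⁅⁆-pos e)))

      innerMin≤1 : ∀ {S} → e ∈ S → innerMin F f x e S ≤E 1#
      innerMin≤1 {S} e∈S = from (innerMin-≤E⇔ f x e S) (⊥ , ⊥-admissible , (begin
        sumOver F x (S ─ ⊥) / contract F f ⊥ S ≡⟨ cong₂ _/_ (cong (sumOver F x) (p─⊥≡p S)) (contract-⊥ f f⊥≡0 S) ⟩
        sumOver F x S / f S                     ≤⟨ from (/≤1⇔≤ (f-pos e∈S)) (x≤f S) ⟩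
        1#                                      ∎))

    waterLevel≤1⇒sumOver≤f : Submodular F f → (∀ e → waterLevel F f x e ≤E 1#) →
                             ∀ S → sumOver F x S ≤ f S
    waterLevel≤1⇒sumOver≤f sub w≤1 = All.wfRec ⊂-wellFounded 0ℓ (λ S → sumOver F x S ≤ f S) step
      where
      step : ∀ S → (∀ {S′} → S′ ⊂ S → sumOver F x S′ ≤ f S′) → sumOver F x S ≤ f S
      step S ih with nonempty? S
      ... | no S-empty rewrite Empty-unique S-empty = ≤-reflexive (trans (sumOver-⊥ x) (sym f⊥≡0))
      ... | yes (e , e∈S) with to (innerMin-≤E⇔ f x e S) (to (waterLevel-≤E⇔ f x e) (w≤1 e) e∈S)
      ...   | T , T-admissible , ratio≤1 = begin
        sumOver F x S                             ≡⟨ sumOver-split x S T ⟩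
        sumOver F x (S ─ T) + sumOver F x (S ∩ T) ≤⟨ +-mono-≤₂ (to (/≤1⇔≤ 0<f_T[S]) ratio≤1) (ih S∩T⊂S) ⟩
        contract F f T S + f (S ∩ T)              ≤⟨ contract+∩≤ f sub T S ⟩
        f S                                       ∎
        where
        e∉T : e ∉ T
        e∉T = T-admissible ∘ contract-⊆ f ∘ x∈p⇒⁅x⁆⊆p

        0<f_T[S] : 0# < contract F f T S
        0<f_T[S] = <-≤-trans (contract-nonneg f mono T ⁅ e ⁆ , ≢-sym T-admissible)
                             (contract-monoʳ f mono T (x∈p⇒⁅x⁆⊆p e∈S))

        S∩T⊂S : S ∩ T ⊂ S
        S∩T⊂S = p∩q⊆p S T , e , e∈S , e∉T ∘ proj₂ ∘ x∈p∩q⁻ S T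

proposition3p5 : (F : OrderedField) → let open OrderedField F in
    (n : ℕ) (f : Subset n → Carrier) (x : Fin n → Carrier) →
    (∀ S → 0# ≤ f S) → Monotone F f → Submodular F f → f ⊥ ≡ 0# →
    (∀ e → 0# < f ⁅ e ⁆) →
    (∀ e → 0# ≤ x e) →
    ((∀ e → waterLevel F f x e ≤E 1#) ⇔ (∀ S → sumOver F x S ≤ f S))
proposition3p5 F n f x _ mono sub f⊥≡0 f⁅⁆-pos _ =
  mk⇔ (waterLevel≤1⇒sumOver≤f F mono f⊥≡0 f⁅⁆-pos sub)
      (sumOver≤f⇒waterLevel≤1 F mono f⊥≡0 f⁅⁆-pos)
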